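{- Let $n>2$ be an integer and let $N$ be an odd integer with $N>100n+100$, not divisible by any prime factor of $n$. Let $B=\{b_1,\dots,b_n\}\subset\mathbb{Z}/N\mathbb{Z}$ be the set $$B=\{1,2,\tfrac{N-n+4}{2},\tfrac{N-n+6}{2},\dots,\tfrac{N+n-4}{2},N-3\}\quad\text{if } n \text{ is odd},$$ $$B=\{1,2,3,\tfrac{N-n+5}{2},\tfrac{N-n+7}{2},\dots,\tfrac{N+n-5}{2},N-6\}\quad\text{if } n \text{ is even}$$ (so $B=\{1,2,N-3\}$ for $n=3$ and $B=\{1,2,3,N-6\}$ for $n=4$). If $\alpha\in(\mathbb{Z}/N\mathbb{Z})^\times$ satisfies $\{\alpha b_1,\dots,\alpha b_n\}=\{b_1,\dots,b_n\}$, then $\alpha=1$. -}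

module Defs where

open import Data.Nat using (ℕ; _+_; _*_; _∸_; _/_; _%_; _≡ᵇ_)
open import Data.Bool using (if_then_else_)
open import Data.List using (List; _∷_; []; map; upTo; _++_)

-- Elements of ℤ/Nℤ are represented by their canonical representatives in {0,…,N-1}.

-- The set B ⊂ ℤ/Nℤ of the paper, as a list of representatives.
--  n odd : 1, 2, (N-n+4)/2, (N-n+6)/2, …, (N+n-4)/2, N-3      (n-3 middle elements)
--  n even: 1, 2, 3, (N-n+5)/2, (N-n+7)/2, …, (N+n-5)/2, N-6   (n-4 middle elements)
-- (The halvings are exact under the theorem's hypotheses since N is odd.)
Bset : ℕ → ℕ → List ℕ
Bset N n =
  if n % 2 ≡ᵇ 1
  then 1 ∷ 2 ∷ (map (λ k → (N ∸ n + 4) / 2 + k) (upTo (n ∸ 3)) ++ (N ∸ 3 ∷ []))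
  else 1 ∷ 2 ∷ 3 ∷ (map (λ k → (N ∸ n + 5) / 2 + k) (upTo (n ∸ 4)) ++ (N ∸ 6 ∷ []))

{-# OPTIONS --safe #-}
-- Write B = S ∪ R ∪ {t} with S = {1,2} or {1,2,3}, t ≡ -3 or -6, and R a run of
-- consecutive residues centred at N/2, so that every element of R is j/2 for an odd j
-- with |j| < n. If αB = B then α = α·1 ∈ B and 2α ∈ B. For α ∈ S ∪ {t}, α ≠ 1, the
-- residue 2α is one of 4, 6, -6, -12, none of which lies in B. For α ∈ R the residue
-- 2α is odd and of absolute value < n, so it is an odd element of S or t itself:
-- α ≡ 1/2, 3/2 (n even) or -3/2 (n odd). These are ruled out by the preimage b of 2:
-- then 4 ≡ 2αb, i.e. b ≡ 4, 3b ≡ 4 or 3b ≡ -4, and no element of B satisfies this.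
module Submission where

open import Defs
open import Data.Nat
open import Data.Nat.Properties
open import Data.Nat.DivMod
open import Data.Nat.Divisibility using (_∣_)
open import Data.Nat.Primality using (Prime)
open import Data.Nat.Coprimality using (Coprime)
open import Data.Nat.Tactic.RingSolver using (solve)
open import Data.List using (List; _∷_; []; map; upTo; _++_)
open import Data.List.Membership.Propositional using (_∈_; _∉_)
open import Data.List.Membership.Propositional.Properties using (∈-++⁻; ∈-map⁻; ∈-upTo⁻)
open import Data.List.Relation.Unary.All as All using (All)
open import Data.List.Relation.Unary.Any using (here; there)
open import Data.Product using (∃; _×_; _,_)
open import Data.Sum using (_⊎_; inj₁; inj₂)
open import Data.Empty using (⊥; ⊥-elim)
open import Relation.Nullary using (¬_; contradiction)
open import Relation.Binary.PropositionalEquality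

B-shape : List ℕ → ℕ → ℕ → ℕ → List ℕ
B-shape S c l t = S ++ map (c +_) (upTo l) ++ t ∷ []

module Shape {S : List ℕ} {c l t : ℕ} where

  ∈-B-shape⁻ : ∀ {x} → x ∈ B-shape S c l t → x ∈ S ⊎ (∃ λ k → k < l × x ≡ c + k) ⊎ x ≡ t
  ∈-B-shape⁻ x∈ with ∈-++⁻ S x∈
  ... | inj₁ x∈S = inj₁ x∈S
  ... | inj₂ x∈rest with ∈-++⁻ (map (c +_) (upTo l)) x∈rest
  ...   | inj₂ (here x≡t) = inj₂ (inj₂ x≡t)
  ...   | inj₁ x∈run with ∈-map⁻ (c +_) x∈run
  ...     | k , k∈ , x≡c+k = inj₂ (inj₁ (k , ∈-upTo⁻ k∈ , x≡c+k))

  ∈-B-shape-below : ∀ {x} → x < c → x < t → x ∈ B-shape S c l t → x ∈ S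
  ∈-B-shape-below x<c x<t x∈ with ∈-B-shape⁻ x∈
  ... | inj₁ x∈S = x∈S
  ... | inj₂ (inj₁ (k , _ , refl)) = contradiction x<c (m+n≮m c k)
  ... | inj₂ (inj₂ refl) = contradiction x<t (n≮n t)

  ∈-B-shape-above : ∀ {x} → All (_< c) S → c + l ≤ x → x ∈ B-shape S c l t → x ≡ t
  ∈-B-shape-above S<c c+l≤x x∈ with ∈-B-shape⁻ x∈
  ... | inj₁ x∈S = contradiction (All.lookup S<c x∈S) (≤⇒≯ (≤-trans (m≤m+n c l) c+l≤x))
  ... | inj₂ (inj₁ (k , k<l , refl)) = contradiction (+-cancelˡ-≤ c l k c+l≤x) (<⇒≱ k<l)
  ... | inj₂ (inj₂ x≡t) = x≡t

  ∈-B-shape-< : ∀ {N x} → All (_< N) S → c + l ≤ N → t < N → x ∈ B-shape S c l t → x < N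
  ∈-B-shape-< S<N c+l≤N t<N x∈ with ∈-B-shape⁻ x∈
  ... | inj₁ x∈S = All.lookup S<N x∈S
  ... | inj₂ (inj₁ (k , k<l , refl)) = <-≤-trans (+-monoʳ-< c k<l) c+l≤N
  ... | inj₂ (inj₂ refl) = t<N

m+k≡n⇒m≤n : ∀ {m n} k → m + k ≡ n → m ≤ n
m+k≡n⇒m≤n {m} k refl = m≤m+n m k

Odd : ℕ → Set
Odd j = ∃ λ i → j ≡ suc (i + i)

odd≢even : ∀ {j} → Odd j → ∀ m → j ≢ m + m
odd≢even (suc i , refl) zero ()
odd≢even (zero , refl) (suc m) eq = 0≢1+n (trans (suc-injective eq) (+-suc m m))
odd≢even (suc i , refl) (suc m) eq rewrite +-suc i i | +-suc m m =
  odd≢even (i , refl) m (suc-injective (suc-injective eq))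

module _ {N : ℕ} .{{_ : NonZero N}} where

  [m+N]%N≡m : ∀ {m} → m < N → (m + N) % N ≡ m
  [m+N]%N≡m {m} m<N = trans ([m+n]%n≡m%n m N) (m<n⇒m%n≡m m<N)

  %-+-congʳ : ∀ {x y} z → x % N ≡ y % N → (x + z) % N ≡ (y + z) % N
  %-+-congʳ {x} {y} z x≡y = begin
    (x + z) % N                ≡⟨ %-distribˡ-+ x z N ⟩
    ((x % N) + (z % N)) % N    ≡⟨ cong (λ w → (w + (z % N)) % N) x≡y ⟩
    ((y % N) + (z % N)) % N    ≡⟨ %-distribˡ-+ y z N ⟨
    (y + z) % N                ∎
    where open ≡-Reasoning

  %-*-congʳ : ∀ {x y} z → x % N ≡ y % N → (x * z) % N ≡ (y * z) % N
  %-*-congʳ {x} {y} z x≡y = begin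
    (x * z) % N                ≡⟨ %-distribˡ-* x z N ⟩
    ((x % N) * (z % N)) % N    ≡⟨ cong (λ w → (w * (z % N)) % N) x≡y ⟩
    ((y % N) * (z % N)) % N    ≡⟨ %-distribˡ-* y z N ⟨
    (y * z) % N                ∎
    where open ≡-Reasoning

record Stabilises (N : ℕ) .{{_ : NonZero N}} (B : List ℕ) (α : ℕ) : Set where
  field
    onto : ∀ x → x ∈ B → ∃ λ b → b ∈ B × x ≡ (α * b) % N
    into : ∀ b → b ∈ B → (α * b) % N ∈ B

module _ {N : ℕ} .{{_ : NonZero N}} {B : List ℕ} {α : ℕ} (stab : Stabilises N B α) where
  open Stabilises stab

  stabiliser-∈ : 1 ∈ B → α < N → α ∈ B
  stabiliser-∈ 1∈B α<N =
    subst (_∈ B) (trans (cong (_% N) (*-identityʳ α)) (m<n⇒m%n≡m α<N)) (into 1 1∈B)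

  preimage-of-two : ∀ {x} → 2 ∈ B → 2 < N → (α * 2) % N ≡ x % N →
                    ∃ λ b → b ∈ B × (x * b) % N ≡ 4 % N
  preimage-of-two {x} 2∈B 2<N 2α≡x with onto 2 2∈B
  ... | b , b∈B , 2≡αb = b , b∈B , (begin
    (x * b) % N        ≡⟨ %-*-congʳ b (sym 2α≡x) ⟩
    (α * 2 * b) % N    ≡⟨ cong (_% N) (solve (α ∷ b ∷ [])) ⟩
    (α * b * 2) % N    ≡⟨ %-*-congʳ 2 (trans (sym 2≡αb) (sym (m<n⇒m%n≡m 2<N))) ⟩
    (2 * 2) % N        ∎)
    where open ≡-Reasoning

  half-unstable : α * 2 ≡ 1 + N → 2 ∈ B → 4 < N → 4 ∉ B → (∀ {b} → b ∈ B → b < N) → ⊥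
  half-unstable 2α≡1+N 2∈B 4<N 4∉B B<N
    with preimage-of-two 2∈B (≤-trans (m≤m+n 3 2) 4<N) (trans (cong (_% N) 2α≡1+N) ([m+n]%n≡m%n 1 N))
  ... | b , b∈B , 1b≡4 = 4∉B (subst (_∈ B) b≡4 b∈B)
    where
    b≡4 : b ≡ 4
    b≡4 = begin
      b            ≡⟨ m<n⇒m%n≡m (B<N b∈B) ⟨
      b % N        ≡⟨ cong (_% N) (*-identityˡ b) ⟨
      (1 * b) % N  ≡⟨ 1b≡4 ⟩
      4 % N        ≡⟨ m<n⇒m%n≡m 4<N ⟩
      4            ∎
      where open ≡-Reasoning

module Centred {N c e : ℕ} (centred : c + c + (e + e) ≡ suc N) where

  open Shape

  centred-≤ : 0 < c → c ≤ N
  centred-≤ 0<c = s≤s⁻¹ (begin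
    suc c              ≡⟨ +-comm 1 c ⟩
    c + 1              ≤⟨ +-monoʳ-≤ c 0<c ⟩
    c + c              ≤⟨ m≤m+n (c + c) (e + e) ⟩
    c + c + (e + e)    ≡⟨ centred ⟩
    suc N              ∎)
    where open ≤-Reasoning

  double-run : ∀ {k} → k < e + e →
    ∃ λ i → i < e × ((c + k) * 2 ≡ suc (i + i) + N ⊎ (c + k) * 2 + suc (i + i) ≡ N)
  double-run {k} k<2e with ≤-<-connex e k
  ... | inj₁ e≤k with m≤n⇒∃[o]m+o≡n e≤k
  ...   | i , e+i≡k = i , +-cancelˡ-< e i e (subst (_< e + e) (sym e+i≡k) k<2e) , inj₁ (begin
    (c + k) * 2               ≡⟨ cong (λ z → (c + z) * 2) (sym e+i≡k) ⟩
    (c + (e + i)) * 2         ≡⟨ solve (c ∷ e ∷ i ∷ []) ⟩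
    c + c + (e + e) + (i + i) ≡⟨ cong (_+ (i + i)) centred ⟩
    suc (N + (i + i))         ≡⟨ cong suc (+-comm N (i + i)) ⟩
    suc (i + i) + N           ∎)
    where open ≡-Reasoning
  double-run {k} k<2e | inj₂ k<e with m≤n⇒∃[o]m+o≡n k<e
  ... | i , 1+k+i≡e = i , subst (i <_) 1+k+i≡e (m<n+m i (s≤s z≤n)) , inj₂ (suc-injective (begin
    suc ((c + k) * 2 + suc (i + i))   ≡⟨ solve (c ∷ k ∷ i ∷ []) ⟩
    c + c + (suc k + i + (suc k + i)) ≡⟨ cong (λ z → c + c + (z + z)) 1+k+i≡e ⟩
    c + c + (e + e)                   ≡⟨ centred ⟩
    suc N                             ∎))
    where open ≡-Reasoning

  double-run-∈ : ∀ .{{_ : NonZero N}} {S t k} → e + e ≤ c → All (_< c) S → c ≤ t → k < e + e →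
    ((c + k) * 2) % N ∈ B-shape S c (e + e) t →
    (∃ λ j → j ∈ S × Odd j × (c + k) * 2 ≡ j + N) ⊎
    (∃ λ j → Odd j × (c + k) * 2 ≡ t × t + j ≡ N)
  double-run-∈ {S} {t} {k} 2e≤c S<c c≤t k<2e 2m∈ with double-run k<2e
  ... | i , i<e , inj₁ 2m≡j+N = inj₁ (suc (i + i) , j∈S , (i , refl) , 2m≡j+N)
    where
    j<c : suc (i + i) < c
    j<c = <-≤-trans (+-mono-≤-< i<e i<e) 2e≤c
    j∈S : suc (i + i) ∈ S
    j∈S = ∈-B-shape-below j<c (<-≤-trans j<c c≤t)
            (subst (_∈ _) (trans (cong (_% N) 2m≡j+N)
                                 ([m+N]%N≡m (<-≤-trans j<c (centred-≤ (≤-<-trans z≤n j<c))))) 2m∈)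
  ... | i , i<e , inj₂ 2m+j≡N =
    inj₂ (suc (i + i) , (i , refl) , 2m≡t , subst (λ z → z + suc (i + i) ≡ N) 2m≡t 2m+j≡N)
    where
    run≤2m : c + (e + e) ≤ (c + k) * 2
    run≤2m = begin
      c + (e + e)        ≤⟨ +-monoʳ-≤ c 2e≤c ⟩
      c + c              ≤⟨ +-mono-≤ (m≤m+n c k) (m≤m+n c k) ⟩
      (c + k) + (c + k)  ≡⟨ solve (c ∷ k ∷ []) ⟩
      (c + k) * 2        ∎
      where open ≤-Reasoning
    2m≡t : (c + k) * 2 ≡ t
    2m≡t = ∈-B-shape-above S<c run≤2m
             (subst (_∈ _) (m<n⇒m%n≡m (subst ((c + k) * 2 <_) 2m+j≡N (m<m+n _ (s≤s z≤n)))) 2m∈)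

  module Gapped (gap : e + e + 13 ≤ c) where

    -- All the linear arithmetic below is checked after substituting this normal form.
    normal-form : ∃ λ g → c ≡ e + e + 13 + g × N ≡ e * 6 + g * 2 + 25
    normal-form with m≤n⇒∃[o]m+o≡n gap
    ... | g , refl = g , refl , suc-injective (trans (sym centred) (solve (e ∷ g ∷ [])))

    13≤c : 13 ≤ c
    13≤c = ≤-trans (m≤n+m 13 (e + e)) gap

    2e≤c : e + e ≤ c
    2e≤c = ≤-trans (m≤m+n (e + e) 13) gap

    c<N : c < N
    c<N with normal-form
    ... | g , refl , refl = m+k≡n⇒m≤n (e * 4 + g + 11) (solve (e ∷ g ∷ []))

    small<N : ∀ {x} → x ≤ 13 → x < N
    small<N x≤13 = ≤-<-trans (≤-trans x≤13 13≤c) c<N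

    small%N : ∀ .{{_ : NonZero N}} x → x ≤ 13 → x % N ≡ x
    small%N x x≤13 = m<n⇒m%n≡m (small<N x≤13)

    run≤top : ∀ {t d} → d ≤ 12 → t + d ≡ N → c + (e + e) ≤ t
    run≤top {t} {d} d≤12 top = +-cancelʳ-≤ d (c + (e + e)) t (begin
      c + (e + e) + d    ≤⟨ +-monoʳ-≤ (c + (e + e)) d≤12 ⟩
      c + (e + e) + 12   ≤⟨ run+12≤N ⟩
      N                  ≡⟨ top ⟨
      t + d              ∎)
      where
      open ≤-Reasoning
      run+12≤N : c + (e + e) + 12 ≤ N
      run+12≤N with normal-form
      ... | g , refl , refl = m+k≡n⇒m≤n (e + e + g) (solve (e ∷ g ∷ []))

    triple-run : ∀ {k} → k < e + e → ∃ λ r → 3 * (c + k) ≡ r + N × 4 < r × r + 4 < N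
    triple-run {k} k<2e with normal-form | m≤n⇒∃[o]m+o≡n k<2e
    ... | g , refl , refl | j , 1+k+j≡2e =
      g + 14 + k * 3 , solve (e ∷ g ∷ k ∷ []) ,
      m+k≡n⇒m≤n (g + 9 + k * 3) (solve (g ∷ k ∷ [])) , m+k≡n⇒m≤n (j * 3 + g + 9) r+4<N
      where
      r+4<N : suc (g + 14 + k * 3 + 4) + (j * 3 + g + 9) ≡ e * 6 + g * 2 + 25
      r+4<N = begin
        suc (g + 14 + k * 3 + 4) + (j * 3 + g + 9) ≡⟨ solve (g ∷ k ∷ j ∷ []) ⟩
        3 * (suc k + j) + g * 2 + 25               ≡⟨ cong (λ z → 3 * z + g * 2 + 25) 1+k+j≡2e ⟩
        3 * (e + e) + g * 2 + 25                   ≡⟨ solve (e ∷ g ∷ []) ⟩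
        e * 6 + g * 2 + 25                         ∎
        where open ≡-Reasoning

module OddCase {N c e t : ℕ} .{{_ : NonZero N}}
  (centred : c + c + (e + e) ≡ suc N) (gap : e + e + 13 ≤ c) (top : t + 3 ≡ N) where

  open Centred {N} {c} {e} centred
  open Gapped gap

  B : List ℕ
  B = B-shape (1 ∷ 2 ∷ []) c (e + e) t

  open Shape {1 ∷ 2 ∷ []} {c} {e + e} {t}

  top-form : ∃ λ g → c ≡ e + e + 13 + g × N ≡ e * 6 + g * 2 + 25 × t ≡ e * 6 + g * 2 + 22
  top-form with normal-form
  ... | g , refl , refl =
    g , refl , refl , +-cancelʳ-≡ 3 t (e * 6 + g * 2 + 22) (trans top (solve (e ∷ g ∷ [])))

  S<c : All (_< c) (1 ∷ 2 ∷ [])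
  S<c = ≤-trans (m≤m+n 2 11) 13≤c All.∷ ≤-trans (m≤m+n 3 10) 13≤c All.∷ All.[]

  t<N : t < N
  t<N = subst (t <_) top (m<m+n t (s≤s z≤n))

  c≤t : c ≤ t
  c≤t = ≤-trans (m≤m+n c (e + e)) (run≤top (m≤m+n 3 9) top)

  B<N : ∀ {b} → b ∈ B → b < N
  B<N = ∈-B-shape-< (All.map (λ b<c → <-trans b<c c<N) S<c)
                    (≤-trans (run≤top (m≤m+n 3 9) top) (<⇒≤ t<N)) t<N

  1∈B : 1 ∈ B
  1∈B = here refl

  2∈B : 2 ∈ B
  2∈B = there (here refl)

  4∉B : 4 ∉ B
  4∉B 4∈B = 4∉S (∈-B-shape-below 4<c (<-≤-trans 4<c c≤t) 4∈B)
    where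
    4<c : 4 < c
    4<c = ≤-trans (m≤m+n 5 8) 13≤c
    4∉S : 4 ∉ 1 ∷ 2 ∷ []
    4∉S (there (there ()))

  double-top : ∃ λ r → t * 2 ≡ r + N × c + (e + e) ≤ r × r < t
  double-top with top-form
  ... | g , refl , refl , refl =
    e * 6 + g * 2 + 19 , solve (e ∷ g ∷ []) ,
    m+k≡n⇒m≤n (e + e + g + 6) (solve (e ∷ g ∷ [])) , m+k≡n⇒m≤n 2 (solve (e ∷ g ∷ []))

  double-top∉B : (t * 2) % N ∉ B
  double-top∉B 2t∈B =
    let r , 2t≡r+N , run≤r , r<t = double-top
        r∈B = subst (_∈ B) (trans (cong (_% N) 2t≡r+N) ([m+N]%N≡m (<-trans r<t t<N))) 2t∈B
    in <-irrefl (∈-B-shape-above S<c run≤r r∈B) r<t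

  triple-top : ∃ λ r → 4 + 3 * t ≡ suc r + 2 * N × suc r < N
  triple-top with top-form
  ... | g , refl , refl , refl =
    e * 6 + g * 2 + 19 , solve (e ∷ g ∷ []) , m+k≡n⇒m≤n 4 (solve (e ∷ g ∷ []))

  4+3b≢0 : ∀ {b} → b ∈ B → (4 + 3 * b) % N ≢ 0
  4+3b≢0 b∈B with ∈-B-shape⁻ b∈B
  ... | inj₁ (here refl) = subst (_≢ 0) (sym (small%N 7 (m≤m+n 7 6))) (λ ())
  ... | inj₁ (there (here refl)) = subst (_≢ 0) (sym (small%N 10 (m≤m+n 10 3))) (λ ())
  ... | inj₂ (inj₁ (k , k<2e , refl)) =
    let r , 3b≡r+N , _ , r+4<N = triple-run k<2e
        residue : (4 + 3 * (c + k)) % N ≡ 4 + r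
        residue = trans (cong (λ z → (4 + z) % N) 3b≡r+N) ([m+N]%N≡m (subst (_< N) (+-comm r 4) r+4<N))
    in subst (_≢ 0) (sym residue) (λ ())
  ... | inj₂ (inj₂ refl) =
    let r , 4+3t≡1+r+2N , 1+r<N = triple-top
        residue : (4 + 3 * t) % N ≡ suc r
        residue = trans (cong (_% N) 4+3t≡1+r+2N) (trans ([m+kn]%n≡m%n (suc r) 2 N) (m<n⇒m%n≡m 1+r<N))
    in subst (_≢ 0) (sym residue) (λ ())

  module _ {α : ℕ} (stab : Stabilises N B α) where
    open Stabilises stab

    top-half-unstable : α * 2 ≡ t → ⊥
    top-half-unstable 2α≡t =
      let b , b∈B , tb≡4 = preimage-of-two stab 2∈B (small<N (m≤m+n 2 11)) (cong (_% N) 2α≡t)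
      in 4+3b≢0 b∈B (begin
        (4 + 3 * b) % N      ≡⟨ %-+-congʳ (3 * b) (sym tb≡4) ⟩
        (t * b + 3 * b) % N  ≡⟨ cong (_% N) (*-distribʳ-+ b t 3) ⟨
        ((t + 3) * b) % N    ≡⟨ cong (λ z → (z * b) % N) top ⟩
        (N * b) % N          ≡⟨ cong (_% N) (*-comm N b) ⟩
        (b * N) % N          ≡⟨ m*n%n≡0 b N ⟩
        0                    ∎)
      where open ≡-Reasoning

    run-unstable : ∀ {k} → k < e + e → α ≡ c + k → ⊥
    run-unstable {k} k<2e α≡c+k =
      doubled (double-run-∈ {k = k} 2e≤c S<c c≤t k<2e
                 (subst (λ a → (a * 2) % N ∈ B) α≡c+k (into 2 2∈B)))
      where
      doubled : (∃ λ j → j ∈ 1 ∷ 2 ∷ [] × Odd j × (c + k) * 2 ≡ j + N) ⊎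
                (∃ λ j → Odd j × (c + k) * 2 ≡ t × t + j ≡ N) → ⊥
      doubled (inj₁ (_ , here refl , _ , 2m≡1+N)) =
        half-unstable stab (trans (cong (_* 2) α≡c+k) 2m≡1+N) 2∈B (small<N (m≤m+n 4 9)) 4∉B B<N
      doubled (inj₁ (_ , there (here refl) , odd , _)) = odd≢even odd 1 refl
      doubled (inj₂ (_ , _ , 2m≡t , _)) = top-half-unstable (trans (cong (_* 2) α≡c+k) 2m≡t)

    stabiliser≡1 : α < N → α ≡ 1
    stabiliser≡1 α<N = cases (∈-B-shape⁻ (stabiliser-∈ stab 1∈B α<N))
      where
      double∈B : ∀ {a} → α ≡ a → (a * 2) % N ∈ B
      double∈B α≡a = subst (λ a → (a * 2) % N ∈ B) α≡a (into 2 2∈B)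
      cases : α ∈ 1 ∷ 2 ∷ [] ⊎ (∃ λ k → k < e + e × α ≡ c + k) ⊎ α ≡ t → α ≡ 1
      cases (inj₁ (here α≡1)) = α≡1
      cases (inj₁ (there (here α≡2))) =
        ⊥-elim (4∉B (subst (_∈ B) (small%N 4 (m≤m+n 4 9)) (double∈B α≡2)))
      cases (inj₂ (inj₁ (k , k<2e , α≡c+k))) = ⊥-elim (run-unstable k<2e α≡c+k)
      cases (inj₂ (inj₂ α≡t)) = ⊥-elim (double-top∉B (double∈B α≡t))

module EvenCase {N c e t : ℕ} .{{_ : NonZero N}}
  (centred : c + c + (e + e) ≡ suc N) (gap : e + e + 13 ≤ c) (top : t + 6 ≡ N) where

  open Centred {N} {c} {e} centred
  open Gapped gap

  B : List ℕ
  B = B-shape (1 ∷ 2 ∷ 3 ∷ []) c (e + e) t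

  open Shape {1 ∷ 2 ∷ 3 ∷ []} {c} {e + e} {t}

  top-form : ∃ λ g → c ≡ e + e + 13 + g × N ≡ e * 6 + g * 2 + 25 × t ≡ e * 6 + g * 2 + 19
  top-form with normal-form
  ... | g , refl , refl =
    g , refl , refl , +-cancelʳ-≡ 6 t (e * 6 + g * 2 + 19) (trans top (solve (e ∷ g ∷ [])))

  S<c : All (_< c) (1 ∷ 2 ∷ 3 ∷ [])
  S<c = ≤-trans (m≤m+n 2 11) 13≤c All.∷ ≤-trans (m≤m+n 3 10) 13≤c All.∷
        ≤-trans (m≤m+n 4 9) 13≤c All.∷ All.[]

  t<N : t < N
  t<N = subst (t <_) top (m<m+n t (s≤s z≤n))

  c≤t : c ≤ t
  c≤t = ≤-trans (m≤m+n c (e + e)) (run≤top (m≤m+n 6 6) top)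

  B<N : ∀ {b} → b ∈ B → b < N
  B<N = ∈-B-shape-< (All.map (λ b<c → <-trans b<c c<N) S<c)
                    (≤-trans (run≤top (m≤m+n 6 6) top) (<⇒≤ t<N)) t<N

  1∈B : 1 ∈ B
  1∈B = here refl

  2∈B : 2 ∈ B
  2∈B = there (here refl)

  4∉B : 4 ∉ B
  4∉B 4∈B = 4∉S (∈-B-shape-below 4<c (<-≤-trans 4<c c≤t) 4∈B)
    where
    4<c : 4 < c
    4<c = ≤-trans (m≤m+n 5 8) 13≤c
    4∉S : 4 ∉ 1 ∷ 2 ∷ 3 ∷ []
    4∉S (there (there (there ())))

  6∉B : 6 ∉ B
  6∉B 6∈B = 6∉S (∈-B-shape-below 6<c (<-≤-trans 6<c c≤t) 6∈B)
    where
    6<c : 6 < c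
    6<c = ≤-trans (m≤m+n 7 6) 13≤c
    6∉S : 6 ∉ 1 ∷ 2 ∷ 3 ∷ []
    6∉S (there (there (there ())))

  double-top : ∃ λ r → t * 2 ≡ r + N × c + (e + e) ≤ r × r < t
  double-top with top-form
  ... | g , refl , refl , refl =
    e * 6 + g * 2 + 13 , solve (e ∷ g ∷ []) ,
    m+k≡n⇒m≤n (e + e + g) (solve (e ∷ g ∷ [])) , m+k≡n⇒m≤n 5 (solve (e ∷ g ∷ []))

  double-top∉B : (t * 2) % N ∉ B
  double-top∉B 2t∈B =
    let r , 2t≡r+N , run≤r , r<t = double-top
        r∈B = subst (_∈ B) (trans (cong (_% N) 2t≡r+N) ([m+N]%N≡m (<-trans r<t t<N))) 2t∈B
    in <-irrefl (∈-B-shape-above S<c run≤r r∈B) r<t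

  triple-top : ∃ λ r → 3 * t ≡ r + 2 * N × 4 < r × r < N
  triple-top with top-form
  ... | g , refl , refl , refl =
    e * 6 + g * 2 + 7 , solve (e ∷ g ∷ []) ,
    m+k≡n⇒m≤n (e * 6 + g * 2 + 2) (solve (e ∷ g ∷ [])) , m+k≡n⇒m≤n 17 (solve (e ∷ g ∷ []))

  3b≢4 : ∀ {b} → b ∈ B → (3 * b) % N ≢ 4
  3b≢4 b∈B with ∈-B-shape⁻ b∈B
  ... | inj₁ (here refl) = subst (_≢ 4) (sym (small%N 3 (m≤m+n 3 10))) (λ ())
  ... | inj₁ (there (here refl)) = subst (_≢ 4) (sym (small%N 6 (m≤m+n 6 7))) (λ ())
  ... | inj₁ (there (there (here refl))) = subst (_≢ 4) (sym (small%N 9 (m≤m+n 9 4))) (λ ())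
  ... | inj₂ (inj₁ (k , k<2e , refl)) =
    let r , 3b≡r+N , 4<r , r+4<N = triple-run k<2e
        residue : (3 * (c + k)) % N ≡ r
        residue = trans (cong (_% N) 3b≡r+N) ([m+N]%N≡m (≤-trans (s≤s (m≤m+n r 4)) r+4<N))
    in subst (_≢ 4) (sym residue) (>⇒≢ 4<r)
  ... | inj₂ (inj₂ refl) =
    let r , 3t≡r+2N , 4<r , r<N = triple-top
        residue : (3 * t) % N ≡ r
        residue = trans (cong (_% N) 3t≡r+2N) (trans ([m+kn]%n≡m%n r 2 N) (m<n⇒m%n≡m r<N))
    in subst (_≢ 4) (sym residue) (>⇒≢ 4<r)

  module _ {α : ℕ} (stab : Stabilises N B α) where
    open Stabilises stab

    three-halves-unstable : α * 2 ≡ 3 + N → ⊥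
    three-halves-unstable 2α≡3+N =
      let b , b∈B , 3b≡4 = preimage-of-two stab 2∈B (small<N (m≤m+n 2 11))
                             (trans (cong (_% N) 2α≡3+N) ([m+n]%n≡m%n 3 N))
      in 3b≢4 b∈B (trans 3b≡4 (small%N 4 (m≤m+n 4 9)))

    run-unstable : ∀ {k} → k < e + e → α ≡ c + k → ⊥
    run-unstable {k} k<2e α≡c+k =
      doubled (double-run-∈ {k = k} 2e≤c S<c c≤t k<2e
                 (subst (λ a → (a * 2) % N ∈ B) α≡c+k (into 2 2∈B)))
      where
      doubled : (∃ λ j → j ∈ 1 ∷ 2 ∷ 3 ∷ [] × Odd j × (c + k) * 2 ≡ j + N) ⊎
                (∃ λ j → Odd j × (c + k) * 2 ≡ t × t + j ≡ N) → ⊥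
      doubled (inj₁ (_ , here refl , _ , 2m≡1+N)) =
        half-unstable stab (trans (cong (_* 2) α≡c+k) 2m≡1+N) 2∈B (small<N (m≤m+n 4 9)) 4∉B B<N
      doubled (inj₁ (_ , there (here refl) , odd , _)) = odd≢even odd 1 refl
      doubled (inj₁ (_ , there (there (here refl)) , _ , 2m≡3+N)) =
        three-halves-unstable (trans (cong (_* 2) α≡c+k) 2m≡3+N)
      doubled (inj₂ (j , odd , _ , t+j≡N)) = odd≢even odd 3 (+-cancelˡ-≡ t j 6 (trans t+j≡N (sym top)))

    stabiliser≡1 : α < N → α ≡ 1
    stabiliser≡1 α<N = cases (∈-B-shape⁻ (stabiliser-∈ stab 1∈B α<N))
      where
      double∈B : ∀ {a} → α ≡ a → (a * 2) % N ∈ B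
      double∈B α≡a = subst (λ a → (a * 2) % N ∈ B) α≡a (into 2 2∈B)
      cases : α ∈ 1 ∷ 2 ∷ 3 ∷ [] ⊎ (∃ λ k → k < e + e × α ≡ c + k) ⊎ α ≡ t → α ≡ 1
      cases (inj₁ (here α≡1)) = α≡1
      cases (inj₁ (there (here α≡2))) =
        ⊥-elim (4∉B (subst (_∈ B) (small%N 4 (m≤m+n 4 9)) (double∈B α≡2)))
      cases (inj₁ (there (there (here α≡3)))) =
        ⊥-elim (6∉B (subst (_∈ B) (small%N 6 (m≤m+n 6 7)) (double∈B α≡3)))
      cases (inj₂ (inj₁ (k , k<2e , α≡c+k))) = ⊥-elim (run-unstable k<2e α≡c+k)
      cases (inj₂ (inj₂ α≡t)) = ⊥-elim (double-top∉B (double∈B α≡t))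

odd⇒1+2h : ∀ {N} → N % 2 ≡ 1 → ∃ λ h → N ≡ suc (h * 2)
odd⇒1+2h {N} N-odd = N / 2 , trans (m≡m%n+[m/n]*n N 2) (cong (_+ (N / 2) * 2) N-odd)

centred-run : ∀ {N e} → N % 2 ≡ 1 → (e * 3 + 12) * 2 < N →
              ∃ λ c → c + c + (e + e) ≡ suc N × e + e + 13 ≤ c
centred-run {N} {e} N-odd N-large with odd⇒1+2h {N} N-odd
... | h , refl with m≤n⇒∃[o]m+o≡n (*-cancelʳ-≤ (e * 3 + 12) h 2 (s≤s⁻¹ N-large))
...   | g , refl = e + e + 13 + g , solve (e ∷ g ∷ []) , m≤m+n (e + e + 13) g

[3e+12]*2≤100[j+2e]+100 : ∀ j e → (e * 3 + 12) * 2 ≤ 100 * (j + (e + e)) + 100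
[3e+12]*2≤100[j+2e]+100 j e = m+k≡n⇒m≤n (j * 100 + e * 194 + 76) (solve (j ∷ e ∷ []))

run-start : ∀ {N n c e} j → c + c + (e + e) ≡ suc N → n ≡ j + (e + e) → suc j ≤ c + c →
            (N ∸ n + suc j) / 2 ≡ c
run-start {N} {n} {c} {e} j centred n≡j+2e 1+j≤2c = trans (cong (_/ 2) N∸n+1+j≡c*2) (m*n/n≡m c 2)
  where
  n≤N : n ≤ N
  n≤N = s≤s⁻¹ (begin
    suc n                 ≡⟨ cong suc n≡j+2e ⟩
    suc j + (e + e)       ≤⟨ +-monoˡ-≤ (e + e) 1+j≤2c ⟩
    c + c + (e + e)       ≡⟨ centred ⟩
    suc N                 ∎)
    where open ≤-Reasoning
  N∸n+1+j≡c*2 : N ∸ n + suc j ≡ c * 2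
  N∸n+1+j≡c*2 = +-cancelʳ-≡ (e + e) (N ∸ n + suc j) (c * 2) (begin
    N ∸ n + suc j + (e + e)     ≡⟨ cong (_+ (e + e)) (+-suc (N ∸ n) j) ⟩
    suc (N ∸ n + j + (e + e))   ≡⟨ cong suc (+-assoc (N ∸ n) j (e + e)) ⟩
    suc (N ∸ n + (j + (e + e))) ≡⟨ cong (λ z → suc (N ∸ n + z)) n≡j+2e ⟨
    suc (N ∸ n + n)             ≡⟨ cong suc (m∸n+n≡m n≤N) ⟩
    suc N                       ≡⟨ centred ⟨
    c + c + (e + e)             ≡⟨ cong (_+ (e + e)) c+c≡c*2 ⟩
    c * 2 + (e + e)             ∎)
    where
    open ≡-Reasoning
    c+c≡c*2 : c + c ≡ c * 2
    c+c≡c*2 = solve (c ∷ [])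

odd-or-even : ∀ {n} → 2 < n → (∃ λ e → n ≡ 3 + (e + e)) ⊎ (∃ λ e → n ≡ 4 + (e + e))
odd-or-even {1} (s≤s ())
odd-or-even {2} (s≤s (s≤s ()))
odd-or-even {3} _ = inj₁ (0 , refl)
odd-or-even {4} _ = inj₂ (0 , refl)
odd-or-even {suc (suc (suc (suc (suc n))))} _ with odd-or-even {3 + n} (s≤s (s≤s (s≤s z≤n)))
... | inj₁ (e , n≡) = inj₁ (suc e , trans (cong (2 +_) n≡) (cong (4 +_) (sym (+-suc e e))))
... | inj₂ (e , n≡) = inj₂ (suc e , trans (cong (2 +_) n≡) (cong (5 +_) (sym (+-suc e e))))

[3+2e]%2≡1 : ∀ e → (3 + (e + e)) % 2 ≡ 1
[3+2e]%2≡1 e = trans (cong (_% 2) 3+2e≡1+[1+e]*2) ([m+kn]%n≡m%n 1 (suc e) 2)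
  where
  3+2e≡1+[1+e]*2 : 3 + (e + e) ≡ 1 + suc e * 2
  3+2e≡1+[1+e]*2 = solve (e ∷ [])

[4+2e]%2≡0 : ∀ e → (4 + (e + e)) % 2 ≡ 0
[4+2e]%2≡0 e = trans (cong (_% 2) 4+2e≡[2+e]*2) ([m+kn]%n≡m%n 0 (2 + e) 2)
  where
  4+2e≡[2+e]*2 : 4 + (e + e) ≡ 0 + (2 + e) * 2
  4+2e≡[2+e]*2 = solve (e ∷ [])

Bset-odd : ∀ N e →
           Bset N (3 + (e + e)) ≡ B-shape (1 ∷ 2 ∷ []) ((N ∸ (3 + (e + e)) + 4) / 2) (e + e) (N ∸ 3)
Bset-odd N e rewrite [3+2e]%2≡1 e = refl

Bset-even : ∀ N e →
            Bset N (4 + (e + e)) ≡ B-shape (1 ∷ 2 ∷ 3 ∷ []) ((N ∸ (4 + (e + e)) + 5) / 2) (e + e) (N ∸ 6)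
Bset-even N e rewrite [4+2e]%2≡0 e = refl

Bset-odd-rigid : ∀ {N e α} .{{_ : NonZero N}} → N % 2 ≡ 1 → 100 * (3 + (e + e)) + 100 < N → α < N →
                 Stabilises N (Bset N (3 + (e + e))) α → α ≡ 1
Bset-odd-rigid {N} {e} {α} N-odd N-large α<N stab =
  rigid (centred-run {N} {e} N-odd (≤-<-trans ([3e+12]*2≤100[j+2e]+100 3 e) N-large))
  where
  rigid : (∃ λ c → c + c + (e + e) ≡ suc N × e + e + 13 ≤ c) → α ≡ 1
  rigid (c , centred , gap) =
    OddCase.stabiliser≡1 {e = e} centred gap top (subst (λ B → Stabilises N B α) Bset≡ stab) α<N
    where
    open Centred {N} {c} {e} centred
    open Gapped gap
    top : N ∸ 3 + 3 ≡ N
    top = m∸n+n≡m (<⇒≤ (small<N (m≤m+n 3 10)))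
    start : (N ∸ (3 + (e + e)) + 4) / 2 ≡ c
    start = run-start {n = 3 + (e + e)} {e = e} 3 centred refl
              (≤-trans (m≤m+n 4 9) (≤-trans 13≤c (m≤m+n c c)))
    Bset≡ : Bset N (3 + (e + e)) ≡ B-shape (1 ∷ 2 ∷ []) c (e + e) (N ∸ 3)
    Bset≡ = trans (Bset-odd N e) (cong (λ s → B-shape (1 ∷ 2 ∷ []) s (e + e) (N ∸ 3)) start)

Bset-even-rigid : ∀ {N e α} .{{_ : NonZero N}} → N % 2 ≡ 1 → 100 * (4 + (e + e)) + 100 < N → α < N →
                  Stabilises N (Bset N (4 + (e + e))) α → α ≡ 1
Bset-even-rigid {N} {e} {α} N-odd N-large α<N stab =
  rigid (centred-run {N} {e} N-odd (≤-<-trans ([3e+12]*2≤100[j+2e]+100 4 e) N-large))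
  where
  rigid : (∃ λ c → c + c + (e + e) ≡ suc N × e + e + 13 ≤ c) → α ≡ 1
  rigid (c , centred , gap) =
    EvenCase.stabiliser≡1 {e = e} centred gap top (subst (λ B → Stabilises N B α) Bset≡ stab) α<N
    where
    open Centred {N} {c} {e} centred
    open Gapped gap
    top : N ∸ 6 + 6 ≡ N
    top = m∸n+n≡m (<⇒≤ (small<N (m≤m+n 6 7)))
    start : (N ∸ (4 + (e + e)) + 5) / 2 ≡ c
    start = run-start {n = 4 + (e + e)} {e = e} 4 centred refl
              (≤-trans (m≤m+n 5 8) (≤-trans 13≤c (m≤m+n c c)))
    Bset≡ : Bset N (4 + (e + e)) ≡ B-shape (1 ∷ 2 ∷ 3 ∷ []) c (e + e) (N ∸ 6)
    Bset≡ = trans (Bset-even N e) (cong (λ s → B-shape (1 ∷ 2 ∷ 3 ∷ []) s (e + e) (N ∸ 6)) start)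

lemma3p1 : (n N : ℕ) → .{{_ : NonZero N}} → n > 2 → N % 2 ≡ 1 → N > 100 * n + 100
    → (∀ p → Prime p → p ∣ n → ¬ (p ∣ N))
    → (α : ℕ) → α < N → Coprime α N
    → (∀ x → x ∈ Bset N n → ∃ λ b → b ∈ Bset N n × x ≡ (α * b) % N)
    → (∀ b → b ∈ Bset N n → (α * b) % N ∈ Bset N n)
    → α ≡ 1
lemma3p1 n N n>2 N-odd N-large _ α α<N _ onto into with odd-or-even n>2
... | inj₁ (e , refl) = Bset-odd-rigid {e = e} N-odd N-large α<N record { onto = onto ; into = into }
... | inj₂ (e , refl) = Bset-even-rigid {e = e} N-odd N-large α<N record { onto = onto ; into = into }
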